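{- Let $\mathcal{H}=(V,\mathcal{E})$ be a Sperner hypergraph in $\mathcal{L}_0$ and let $e_0\in\mathcal{E}$. Let $\mathcal{H}/e_0=(V/e_0,\mathcal{E}/e_0)$ be obtained by contracting $e_0$, with new vertex $w\notin V$, and let $(\mathcal{E}/e_0)^*$ be the edge set of its Sperner subhypergraph. Then $$(\mathcal{E}/e_0)^*\subseteq\{e\in\mathcal{E}: e\cap e_0=\emptyset\}\cup\{(e\setminus e_0)\cup\{w\}: e\in\mathcal{E},\ |e\cap e_0|=1\}.$$
   Context: A hypergraph $\mathcal{H}=(V,\mathcal{E})$ consists of a finite vertex set $V$ and a set $\mathcal{E}$ of non-empty subsets of $V$ (edges). A cycle in $\mathcal{H}$ is a sequence $(v_1,e_1,\ldots,v_t,e_t,v_1)$ with $t\ge2$, pairwise distinct vertices $v_1,\ldots,v_t$, pairwise distinct edges $e_1,\ldots,e_t$, and $\{v_i,v_{i+1}\}\subseteq e_i$ ($v_{t+1}=v_1$); it is also written $(e_1,\ldots,e_t)$. $\mathcal{L}_0$ is the set of hypergraphs in which every edge has even size and every cycle $(e_1,\ldots,e_r)$ has distinct vertices $u,v\in\bigcup_i e_i$ with $\{u,v\}$ an edge. $\mathcal{H}$ is Sperner if no edge is contained in a different edge. For $V_0\subseteq V$, $\mathcal{H}\cdot V_0$ is the hypergraph with vertex set $(V\setminus V_0)\cup\{w\}$ ($w$ a new vertex) and edge set $\{e\in\mathcal{E}:e\cap V_0=\emptyset\}\cup\{(e\setminus V_0)\cup\{w\}: e\in\mathcal{E}, e\cap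 V_0\ne\emptyset\}$; for an edge $e$, $\mathcal{H}/e=(\mathcal{H}-e)\cdot e$, where $\mathcal{H}-e$ removes the edge $e$. The Sperner subhypergraph of $(V,\mathcal{E})$ is $(V,\mathcal{E}^*)$ where $\mathcal{E}^*$ is the minimal subset of $\mathcal{E}$ such that every $e\in\mathcal{E}\setminus\mathcal{E}^*$ contains some $e'\in\mathcal{E}^*$ (equivalently, remove every edge that properly contains another edge). -}

module Defs where

open import Data.Nat using (ℕ; suc; _≤_)
open import Data.Nat.Divisibility using (_∣_)
open import Data.Fin using (Fin; zero; suc; fromℕ; inject₁)
open import Data.Fin.Subset using (Subset; _∈_; _⊆_; _∩_; _∪_; ∁; ⁅_⁆; ∣_∣; Nonempty; Empty; inside; outside)
open import Data.Vec using (_∷_)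
open import Data.Sum using (_⊎_)
open import Data.Product using (Σ; ∃; _×_; _,_)
open import Relation.Binary.PropositionalEquality using (_≡_; _≢_)
open import Relation.Nullary using (¬_)
open import Function.Definitions using (Injective)

EdgeSet : ℕ → Set₁
EdgeSet n = Subset n → Set

record Hypergraph (n : ℕ) : Set₁ where
  field
    E        : EdgeSet n
    nonempty : ∀ e → E e → Nonempty e
open Hypergraph public

_∖_ : ∀ {n} → Subset n → Subset n → Subset n
p ∖ q = p ∩ ∁ q

-- Cycle (v₁,e₁,…,v_t,e_t,v₁) with t = 2 + k ≥ 2, pairwise distinct vertices and
-- pairwise distinct edges, {v_i, v_{i+1}} ⊆ e_i (indices mod t).
record Cycle {n : ℕ} (E : EdgeSet n) : Set where
  field
    k      : ℕ
    vs     : Fin (suc (suc k)) → Fin n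
    es     : Fin (suc (suc k)) → Subset n
    vs-inj : Injective _≡_ _≡_ vs
    es-inj : Injective _≡_ _≡_ es
    es-E   : ∀ i → E (es i)
    v-in   : ∀ i → vs i ∈ es i
    v-next : ∀ (i : Fin (suc k)) → vs (suc i) ∈ es (inject₁ i)
    v-wrap : vs zero ∈ es (fromℕ (suc k))
open Cycle public

InCycle : ∀ {n} {E : EdgeSet n} → Cycle E → Fin n → Set
InCycle C u = ∃ λ i → u ∈ es C i

InL0 : ∀ {n} → Hypergraph n → Set
InL0 H =
  (∀ e → E H e → 2 ∣ ∣ e ∣)
  × (∀ (C : Cycle (E H)) →
       Σ (Fin _) λ u → Σ (Fin _) λ v →
         u ≢ v × InCycle C u × InCycle C v × E H (⁅ u ⁆ ∪ ⁅ v ⁆))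

Sperner : ∀ {n} → Hypergraph n → Set
Sperner H = ∀ e e' → E H e → E H e' → e ⊆ e' → e ≡ e'

SpernerEdges : ∀ {n} → EdgeSet n → EdgeSet n
SpernerEdges E e = E e × ¬ (∃ λ e' → E e' × e' ⊆ e × e' ≢ e)

-- Contraction H / e₀ = (H - e₀)·e₀.  Its vertex set (V ∖ e₀) ∪ {w} is embedded in
-- Fin (suc n): the new vertex w is zero, old vertex i is suc i (vertices of e₀ are
-- then unused).  A subset of Fin (suc n) is (w-bit ∷ old part).
ContractEdges : ∀ {n} → EdgeSet n → Subset n → EdgeSet (suc n)
ContractEdges E e₀ e' = ∃ λ e → E e × e ≢ e₀ ×
  ((Empty (e ∩ e₀) × e' ≡ outside ∷ e)
   ⊎ (Nonempty (e ∩ e₀) × e' ≡ inside ∷ (e ∖ e₀)))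

-- If e meets e₀ in two vertices y ≠ z, then (y, e, z, e₀, y) is a cycle, so 𝓛₀ provides
-- an edge f = {a, b} inside e ∪ e₀.  By the Sperner property f cannot lie in e (it would
-- be e, which meets e₀) nor in e₀ (it would be e₀ = {y, z} ⊆ e).  So f meets e₀ in one
-- vertex and has its other vertex in e ∖ e₀; then f/e₀ ⊆ e/e₀, and minimality of e/e₀
-- forces e/e₀ = f/e₀.

module Submission where

open import Defs
open import Data.Nat using (ℕ)
open import Data.Fin.Subset using (Subset; _∩_; ∣_∣; Empty; inside; outside)
open import Data.Vec using (_∷_)
open import Data.Product using (∃; _×_)
open import Data.Sum using (_⊎_)
open import Relation.Binary.PropositionalEquality using (_≡_)

open import Data.Bool using () renaming (_≟_ to _≟ᵇ_)
open import Data.Empty using (⊥-elim)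
open import Data.Fin using (Fin; zero; suc; _≟_)
open import Data.Fin.Subset using (_∈_; _∉_; _⊆_; _∪_; ∁; ⁅_⁆)
open import Data.Fin.Subset.Properties
open import Data.Product using (∃₂; _,_; proj₁; proj₂)
open import Data.Sum using (inj₁; inj₂)
open import Data.Vec.Properties using (≡-dec)
open import Function.Definitions using (Injective)
open import Relation.Nullary using (yes; no)
open import Relation.Binary.PropositionalEquality using (_≢_; refl; sym; trans; cong; subst)

private
  variable
    n : ℕ
    u x y z : Fin n
    p q : Subset n

x∈p∖q⁺ : x ∈ p → x ∉ q → x ∈ p ∖ q
x∈p∖q⁺ x∈p x∉q = x∈p∩q⁺ (x∈p , x∉p⇒x∈∁p x∉q)

x∈p∖q⁻ : ∀ (p q : Subset n) → x ∈ p ∖ q → x ∈ p × x ∉ q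
x∈p∖q⁻ p q x∈p∖q with x∈p∩q⁻ p (∁ q) x∈p∖q
... | x∈p , x∈∁q = x∈p , x∈∁p⇒x∉p x∈∁q

x∈p∪q∧x∉q⇒x∈p : x ∈ p ∪ q → x ∉ q → x ∈ p
x∈p∪q∧x∉q⇒x∈p {p = p} {q = q} x∈p∪q x∉q with x∈p∪q⁻ p q x∈p∪q
... | inj₁ x∈p = x∈p
... | inj₂ x∈q = ⊥-elim (x∉q x∈q)

x∈⁅y⁆∪⁅z⁆⁻ : x ∈ ⁅ y ⁆ ∪ ⁅ z ⁆ → x ≡ y ⊎ x ≡ z
x∈⁅y⁆∪⁅z⁆⁻ {y = y} {z} x∈ with x∈p∪q⁻ ⁅ y ⁆ ⁅ z ⁆ x∈
... | inj₁ x∈⁅y⁆ = inj₁ (x∈⁅y⁆⇒x≡y y x∈⁅y⁆)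
... | inj₂ x∈⁅z⁆ = inj₂ (x∈⁅y⁆⇒x≡y z x∈⁅z⁆)

y∈⁅y⁆∪⁅z⁆ : ∀ (y z : Fin n) → y ∈ ⁅ y ⁆ ∪ ⁅ z ⁆
y∈⁅y⁆∪⁅z⁆ y z = x∈p∪q⁺ (inj₁ (x∈⁅x⁆ y))

z∈⁅y⁆∪⁅z⁆ : ∀ (y z : Fin n) → z ∈ ⁅ y ⁆ ∪ ⁅ z ⁆
z∈⁅y⁆∪⁅z⁆ y z = x∈p∪q⁺ (inj₂ (x∈⁅x⁆ z))

⁅y⁆∪⁅z⁆⊆p : y ∈ p → z ∈ p → ⁅ y ⁆ ∪ ⁅ z ⁆ ⊆ p
⁅y⁆∪⁅z⁆⊆p y∈p z∈p t∈ with x∈⁅y⁆∪⁅z⁆⁻ t∈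
... | inj₁ refl = y∈p
... | inj₂ refl = z∈p

⁅a⁆∪⁅b⁆⊆⁅y⁆∪⁅z⁆ : ∀ {a b} → y ≢ z → y ∈ ⁅ a ⁆ ∪ ⁅ b ⁆ → z ∈ ⁅ a ⁆ ∪ ⁅ b ⁆ →
                  ⁅ a ⁆ ∪ ⁅ b ⁆ ⊆ ⁅ y ⁆ ∪ ⁅ z ⁆
⁅a⁆∪⁅b⁆⊆⁅y⁆∪⁅z⁆ {y = y} {z} y≢z y∈ z∈ t∈
  with x∈⁅y⁆∪⁅z⁆⁻ t∈ | x∈⁅y⁆∪⁅z⁆⁻ y∈ | x∈⁅y⁆∪⁅z⁆⁻ z∈
... | inj₁ refl | inj₁ refl | _         = y∈⁅y⁆∪⁅z⁆ y z
... | inj₁ refl | inj₂ refl | inj₁ refl = z∈⁅y⁆∪⁅z⁆ y z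
... | inj₁ refl | inj₂ refl | inj₂ refl = ⊥-elim (y≢z refl)
... | inj₂ refl | inj₂ refl | _         = y∈⁅y⁆∪⁅z⁆ y z
... | inj₂ refl | inj₁ refl | inj₂ refl = z∈⁅y⁆∪⁅z⁆ y z
... | inj₂ refl | inj₁ refl | inj₁ refl = ⊥-elim (y≢z refl)

∣p∣≡1⊎∃≢ : x ∈ p → ∣ p ∣ ≡ 1 ⊎ ∃ λ z → z ∈ p × z ≢ x
∣p∣≡1⊎∃≢ {x = x} {p = p} x∈p with nonempty? (p ∖ ⁅ x ⁆)
... | yes (z , z∈) with x∈p∖q⁻ p ⁅ x ⁆ z∈
...   | z∈p , z∉⁅x⁆ = inj₂ (z , z∈p , x∉⁅y⁆⇒x≢y z∉⁅x⁆)
∣p∣≡1⊎∃≢ {x = x} {p = p} x∈p | no ∄ =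
  inj₁ (trans (cong ∣_∣ (⊆-antisym p⊆⁅x⁆ ⁅x⁆⊆p)) (∣⁅x⁆∣≡1 x))
  where
  p⊆⁅x⁆ : p ⊆ ⁅ x ⁆
  p⊆⁅x⁆ {t} t∈p with t ≟ x
  ... | yes refl = x∈⁅x⁆ x
  ... | no t≢x   = ⊥-elim (∄ (t , x∈p∖q⁺ t∈p (x≢y⇒x∉⁅y⁆ t≢x)))
  ⁅x⁆⊆p : ⁅ x ⁆ ⊆ p
  ⁅x⁆⊆p t∈⁅x⁆ with x∈⁅y⁆⇒x≡y x t∈⁅x⁆
  ... | refl = x∈p

⁅x⁆∪⁅u⁆∩q≡⁅u⁆ : x ∉ q → u ∈ q → (⁅ x ⁆ ∪ ⁅ u ⁆) ∩ q ≡ ⁅ u ⁆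
⁅x⁆∪⁅u⁆∩q≡⁅u⁆ {x = x} {q = q} {u = u} x∉q u∈q = ⊆-antisym ⊆⁅u⁆ ⁅u⁆⊆
  where
  ⊆⁅u⁆ : (⁅ x ⁆ ∪ ⁅ u ⁆) ∩ q ⊆ ⁅ u ⁆
  ⊆⁅u⁆ t∈ with x∈p∩q⁻ (⁅ x ⁆ ∪ ⁅ u ⁆) q t∈
  ... | t∈pair , t∈q with x∈⁅y⁆∪⁅z⁆⁻ t∈pair
  ...   | inj₁ refl = ⊥-elim (x∉q t∈q)
  ...   | inj₂ refl = x∈⁅x⁆ u
  ⁅u⁆⊆ : ⁅ u ⁆ ⊆ (⁅ x ⁆ ∪ ⁅ u ⁆) ∩ q
  ⁅u⁆⊆ t∈⁅u⁆ with x∈⁅y⁆⇒x≡y u t∈⁅u⁆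
  ... | refl = x∈p∩q⁺ (z∈⁅y⁆∪⁅z⁆ x u , u∈q)

⁅x⁆∪⁅u⁆∖q⊆p∖q : x ∈ p → u ∈ q → (⁅ x ⁆ ∪ ⁅ u ⁆) ∖ q ⊆ p ∖ q
⁅x⁆∪⁅u⁆∖q⊆p∖q {x = x} {u = u} {q = q} x∈p u∈q t∈ with x∈p∖q⁻ (⁅ x ⁆ ∪ ⁅ u ⁆) q t∈
... | t∈pair , t∉q with x∈⁅y⁆∪⁅z⁆⁻ t∈pair
...   | inj₁ refl = x∈p∖q⁺ x∈p t∉q
...   | inj₂ refl = ⊥-elim (t∉q u∈q)

Fin2-injective : ∀ {A : Set} (f : Fin 2 → A) → f zero ≢ f (suc zero) → Injective _≡_ _≡_ f
Fin2-injective f f0≢f1 {zero}     {zero}     _  = refl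
Fin2-injective f f0≢f1 {zero}     {suc zero} eq = ⊥-elim (f0≢f1 eq)
Fin2-injective f f0≢f1 {suc zero} {zero}     eq = ⊥-elim (f0≢f1 (sym eq))
Fin2-injective f f0≢f1 {suc zero} {suc zero} _  = refl

module TwoEdgeCycle {E : EdgeSet n} {e e₀ : Subset n} (Ee : E e) (Ee₀ : E e₀) (e≢e₀ : e ≢ e₀)
                    (y≢z : y ≢ z) (y∈e : y ∈ e) (y∈e₀ : y ∈ e₀) (z∈e : z ∈ e) (z∈e₀ : z ∈ e₀) where

  twoEdgeCycle : Cycle E
  twoEdgeCycle = record
    { k = 0 ; vs = vertex ; es = edge
    ; vs-inj = Fin2-injective vertex y≢z ; es-inj = Fin2-injective edge e≢e₀
    ; es-E = λ { zero → Ee ; (suc zero) → Ee₀ }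
    ; v-in = λ { zero → y∈e ; (suc zero) → z∈e₀ }
    ; v-next = λ { zero → z∈e }
    ; v-wrap = y∈e₀ }
    where
    vertex : Fin 2 → Fin _
    vertex zero = y
    vertex (suc zero) = z
    edge : Fin 2 → Subset _
    edge zero = e
    edge (suc zero) = e₀

  InCycle-twoEdgeCycle⇒∈∪ : InCycle twoEdgeCycle x → x ∈ e ∪ e₀
  InCycle-twoEdgeCycle⇒∈∪ (zero , x∈e) = x∈p∪q⁺ (inj₁ x∈e)
  InCycle-twoEdgeCycle⇒∈∪ (suc zero , x∈e₀) = x∈p∪q⁺ (inj₂ x∈e₀)

record PairEdgeIn (H : Hypergraph n) (s : Subset n) : Set where
  constructor pairEdge
  field
    a b  : Fin n
    a∈s  : a ∈ s
    b∈s  : b ∈ s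
    edge : E H (⁅ a ⁆ ∪ ⁅ b ⁆)

module _ {H : Hypergraph n} {e e₀ : Subset n} (Ee : E H e) (Ee₀ : E H e₀) (e≢e₀ : e ≢ e₀)
         (y≢z : y ≢ z) (y∈e∩e₀ : y ∈ e ∩ e₀) (z∈e∩e₀ : z ∈ e ∩ e₀) where

  private
    y∈e : y ∈ e
    y∈e = proj₁ (x∈p∩q⁻ e e₀ y∈e∩e₀)
    y∈e₀ : y ∈ e₀
    y∈e₀ = proj₂ (x∈p∩q⁻ e e₀ y∈e∩e₀)
    z∈e : z ∈ e
    z∈e = proj₁ (x∈p∩q⁻ e e₀ z∈e∩e₀)
    z∈e₀ : z ∈ e₀
    z∈e₀ = proj₂ (x∈p∩q⁻ e e₀ z∈e∩e₀)

  open TwoEdgeCycle {E = E H} Ee Ee₀ e≢e₀ y≢z y∈e y∈e₀ z∈e z∈e₀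

  InL0⇒pairEdgeIn-∪ : InL0 H → PairEdgeIn H (e ∪ e₀)
  InL0⇒pairEdgeIn-∪ (_ , cycle⇒chord) with cycle⇒chord twoEdgeCycle
  ... | a , b , _ , a∈C , b∈C , Eab =
    pairEdge a b (InCycle-twoEdgeCycle⇒∈∪ a∈C) (InCycle-twoEdgeCycle⇒∈∪ b∈C) Eab

  Sperner⇒crossingPairEdge : Sperner H → PairEdgeIn H (e ∪ e₀) →
                             ∃₂ λ x u → x ∈ e ∖ e₀ × u ∈ e₀ × E H (⁅ x ⁆ ∪ ⁅ u ⁆)
  Sperner⇒crossingPairEdge sp (pairEdge a b a∈ b∈ Eab) with a ∈? e₀ | b ∈? e₀
  ... | no a∉e₀ | yes b∈e₀ = a , b , x∈p∖q⁺ (x∈p∪q∧x∉q⇒x∈p a∈ a∉e₀) a∉e₀ , b∈e₀ , Eab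
  ... | yes a∈e₀ | no b∉e₀ =
    b , a , x∈p∖q⁺ (x∈p∪q∧x∉q⇒x∈p b∈ b∉e₀) b∉e₀ , a∈e₀ , subst (E H) (∪-comm ⁅ a ⁆ ⁅ b ⁆) Eab
  ... | no a∉e₀ | no b∉e₀ with x∈⁅y⁆∪⁅z⁆⁻ (subst (z ∈_) (sym ab≡e) z∈e)
    where
    ab≡e : ⁅ a ⁆ ∪ ⁅ b ⁆ ≡ e
    ab≡e = sp _ e Eab Ee (⁅y⁆∪⁅z⁆⊆p (x∈p∪q∧x∉q⇒x∈p a∈ a∉e₀) (x∈p∪q∧x∉q⇒x∈p b∈ b∉e₀))
  ...   | inj₁ refl = ⊥-elim (a∉e₀ z∈e₀)
  ...   | inj₂ refl = ⊥-elim (b∉e₀ z∈e₀)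
  Sperner⇒crossingPairEdge sp (pairEdge a b _ _ Eab) | yes a∈e₀ | yes b∈e₀ =
    ⊥-elim (e≢e₀ (sym (sp e₀ e Ee₀ Ee e₀⊆e)))
    where
    ab≡e₀ : ⁅ a ⁆ ∪ ⁅ b ⁆ ≡ e₀
    ab≡e₀ = sp _ e₀ Eab Ee₀ (⁅y⁆∪⁅z⁆⊆p a∈e₀ b∈e₀)
    e₀⊆yz : e₀ ⊆ ⁅ y ⁆ ∪ ⁅ z ⁆
    e₀⊆yz = subst (_⊆ ⁅ y ⁆ ∪ ⁅ z ⁆) ab≡e₀ (⁅a⁆∪⁅b⁆⊆⁅y⁆∪⁅z⁆ y≢z
              (subst (y ∈_) (sym ab≡e₀) y∈e₀) (subst (z ∈_) (sym ab≡e₀) z∈e₀))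
    e₀⊆e : e₀ ⊆ e
    e₀⊆e = ⊆-trans e₀⊆yz (⁅y⁆∪⁅z⁆⊆p y∈e z∈e)

SpernerEdges⇒minimal : ∀ {E : EdgeSet n} {e f : Subset n} → SpernerEdges E e → E f → f ⊆ e → f ≡ e
SpernerEdges⇒minimal {e = e} {f} (_ , ∄smaller) Ef f⊆e with ≡-dec _≟ᵇ_ f e
... | yes f≡e = f≡e
... | no f≢e  = ⊥-elim (∄smaller (f , Ef , f⊆e , f≢e))

lemma3p1 : ∀ {n : ℕ} (H : Hypergraph n) → Sperner H → InL0 H →
    ∀ (e₀ : Subset n) → E H e₀ →
    ∀ (e' : Subset _) → SpernerEdges (ContractEdges (E H) e₀) e' →
      (∃ λ e → E H e × Empty (e ∩ e₀) × e' ≡ outside ∷ e)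
      ⊎ (∃ λ e → E H e × ∣ e ∩ e₀ ∣ ≡ 1 × e' ≡ inside ∷ (e ∖ e₀))
lemma3p1 H sp l0 e₀ Ee₀ e' ((e , Ee , _ , inj₁ (e∩e₀-empty , e'≡)) , _) =
  inj₁ (e , Ee , e∩e₀-empty , e'≡)
lemma3p1 H sp l0 e₀ Ee₀ _ e'-min@((e , Ee , e≢e₀ , inj₂ ((y , y∈e∩e₀) , refl)) , _)
  with ∣p∣≡1⊎∃≢ y∈e∩e₀
... | inj₁ ∣e∩e₀∣≡1 = inj₂ (e , Ee , ∣e∩e₀∣≡1 , refl)
... | inj₂ (z , z∈e∩e₀ , z≢y)
  with Sperner⇒crossingPairEdge Ee Ee₀ e≢e₀ z≢y z∈e∩e₀ y∈e∩e₀ sp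
         (InL0⇒pairEdgeIn-∪ {H = H} Ee Ee₀ e≢e₀ z≢y z∈e∩e₀ y∈e∩e₀ l0)
... | x , u , x∈e∖e₀ , u∈e₀ , Ef =
  inj₂ (f , Ef , ∣f∩e₀∣≡1 , sym (SpernerEdges⇒minimal e'-min f/e₀-contracted f/e₀⊆e/e₀))
  where
  f : Subset _
  f = ⁅ x ⁆ ∪ ⁅ u ⁆
  x∉e₀ : x ∉ e₀
  x∉e₀ = proj₂ (x∈p∖q⁻ e e₀ x∈e∖e₀)
  ∣f∩e₀∣≡1 : ∣ f ∩ e₀ ∣ ≡ 1
  ∣f∩e₀∣≡1 = trans (cong ∣_∣ (⁅x⁆∪⁅u⁆∩q≡⁅u⁆ x∉e₀ u∈e₀)) (∣⁅x⁆∣≡1 u)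
  f/e₀-contracted : ContractEdges (E H) e₀ (inside ∷ (f ∖ e₀))
  f/e₀-contracted = f , Ef , (λ f≡e₀ → x∉e₀ (subst (x ∈_) f≡e₀ (y∈⁅y⁆∪⁅z⁆ x u)))
                  , inj₂ ((u , x∈p∩q⁺ (z∈⁅y⁆∪⁅z⁆ x u , u∈e₀)) , refl)
  f/e₀⊆e/e₀ : inside ∷ (f ∖ e₀) ⊆ inside ∷ (e ∖ e₀)
  f/e₀⊆e/e₀ = in⊆in (⁅x⁆∪⁅u⁆∖q⊆p∖q (proj₁ (x∈p∖q⁻ e e₀ x∈e∖e₀)) u∈e₀)
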